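{- For $x \in \mathbb{C}$ and $n\in\mathbb{N}_0$, $$\sum_{k=1}^n k^3 H_k^{(2)}(x) = \frac{(n-x)(x+n+1)(x^2+x+n+n^2)}{4} H_n^{(2)}(x) + \frac{x(x+1)(2x+1)}{2} H_n(x) - \frac{(18x^2+18x-6nx+1-3n+2n^2)n}{24}.$$
   Context: For $x\in\mathbb{C}$, $l,n\in\mathbb{N}_0$, $H_0^{(l)}(x)=0$ and $H_n^{(l)}(x)=\sum_{k=1}^n \frac{1}{(x+k)^l}$ for $n\ge 1$ (defined whenever $x$ is not one of $-1,\dots,-n$); $H_n(x)=H_n^{(1)}(x)$. -}

module Defs where

open import Level using (Level; _⊔_) renaming (suc to lsuc)
open import Data.Nat using (ℕ; zero; suc; _≤_)
open import Relation.Nullary using (¬_)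
open import Algebra.Bundles using (CommutativeRing)

-- A field, presented as a commutative ring with a total inverse operation
-- (the value of 0⁻¹ is irrelevant), as in e.g. Lean/mathlib.
-- ℂ is an instance of this record.
record Field (c ℓ : Level) : Set (lsuc (c ⊔ ℓ)) where
  field
    commutativeRing : CommutativeRing c ℓ
  open CommutativeRing commutativeRing public
  infix 8 _⁻¹
  field
    _⁻¹      : Carrier → Carrier
    ⁻¹-cong  : ∀ {x y} → x ≈ y → x ⁻¹ ≈ y ⁻¹
    inverseʳ : ∀ x → ¬ (x ≈ 0#) → x * x ⁻¹ ≈ 1#

module FieldOps {c ℓ : Level} (F : Field c ℓ) where
  open Field F

  ι : ℕ → Carrier
  ι zero    = 0#
  ι (suc n) = 1# + ι n

  _^ᶠ_ : Carrier → ℕ → Carrier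
  x ^ᶠ zero  = 1#
  x ^ᶠ suc l = x * (x ^ᶠ l)

  Σ[1to_] : ℕ → (ℕ → Carrier) → Carrier
  Σ[1to zero  ] f = 0#
  Σ[1to suc n ] f = Σ[1to n ] f + f (suc n)

  H : ℕ → ℕ → Carrier → Carrier
  H l n x = Σ[1to n ] (λ k → ((x + ι k) ^ᶠ l) ⁻¹)

CharZero : ∀ {c ℓ} → Field c ℓ → Set ℓ
CharZero F = ∀ n → ¬ (ι (suc n) ≈ 0#)
  where open Field F
        open FieldOps F

module Submission where

-- The identity is proved by telescoping: writing closedForm n
-- for the right-hand side, it suffices that closedForm 0 = 0 and
--   closedForm (n+1) = closedForm n + (n+1)³ H⁽²⁾ₙ₊₁(x).
-- To verify the step we put the right-hand side over the common denominator
-- 24 (using 1/4 = 6/24 and 1/2 = 12/24) and view its numerator as a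
-- polynomial in N = n, x, h₁ = Hₙ(x), h₂ = H⁽²⁾ₙ(x).  Passing from n to n+1
-- replaces h₁, h₂ by h₁ + 1/y, h₂ + 1/y² with y = x + n + 1; a ring-solver
-- expansion shows that the numerator then grows by 24 (n+1)³ H⁽²⁾ₙ₊₁(x) plus a
-- remainder p + q/y + r/y², and after clearing the denominators the
-- remainder y²p + yq + r is the zero polynomial.

open import Defs

open import Algebra.Bundles using (CommutativeRing)
open import Data.Nat.Base as ℕ using (ℕ; zero; suc; _≤_; z≤n; s≤s)
open import Data.Integer.Base as ℤ using (ℤ; +_; -[1+_])
import Data.Integer.Properties as ℤ
import Data.Nat.Properties as ℕ
open import Data.Sign.Base as Sign using (Sign)
open import Data.Maybe.Base using (Maybe; just; nothing)
open import Relation.Nullary.Decidable using (yes; no)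
open import Relation.Nullary.Negation using (¬_)
import Relation.Binary.PropositionalEquality.Core as ≡
import Algebra.Solver.Ring.AlmostCommutativeRing as ACR

module IntegerCoefficients {c ℓ} (R : CommutativeRing c ℓ) where
  open CommutativeRing R
  open import Algebra.Properties.Semiring.Mult semiring using (_×_; ×-homo-+; ×1-homo-*)
  open import Algebra.Properties.Ring ring using (-1*x≈-x; -‿involutive; -0#≈0#)
  open import Algebra.Properties.AbelianGroup +-abelianGroup using (⁻¹-∙-comm)
  open import Relation.Binary.Reasoning.Setoid setoid

  embed : ℤ → Carrier
  embed (+ n)    = n × 1#
  embed -[1+ n ] = - (suc n × 1#)

  signValue : Sign → Carrier
  signValue Sign.+ = 1#
  signValue Sign.- = - 1#

  embed-◃ : ∀ s n → embed (s ℤ.◃ n) ≈ signValue s * (n × 1#)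
  embed-◃ s      zero    = sym (zeroʳ _)
  embed-◃ Sign.+ (suc n) = sym (*-identityˡ _)
  embed-◃ Sign.- (suc n) = sym (-1*x≈-x _)

  signValue-* : ∀ s t → signValue (s Sign.* t) ≈ signValue s * signValue t
  signValue-* Sign.+ t      = sym (*-identityˡ _)
  signValue-* Sign.- Sign.+ = sym (*-identityʳ _)
  signValue-* Sign.- Sign.- = sym (trans (-1*x≈-x _) (-‿involutive _))

  embed-sign-abs : ∀ i → embed i ≈ signValue (ℤ.sign i) * (ℤ.∣ i ∣ × 1#)
  embed-sign-abs i = begin
    embed i                                ≡⟨ ≡.cong embed (ℤ.◃-inverse i) ⟨
    embed (ℤ.sign i ℤ.◃ ℤ.∣ i ∣)           ≈⟨ embed-◃ (ℤ.sign i) ℤ.∣ i ∣ ⟩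
    signValue (ℤ.sign i) * (ℤ.∣ i ∣ × 1#)  ∎

  sub-cancelˡ : ∀ o a b → (o + a) - (o + b) ≈ a - b
  sub-cancelˡ o a b = begin
    (o + a) + - (o + b)    ≈⟨ +-cong (+-comm a o) (⁻¹-∙-comm o b) ⟨
    (a + o) + (- o + - b)  ≈⟨ +-assoc a o _ ⟩
    a + (o + (- o + - b))  ≈⟨ +-congˡ (+-assoc o (- o) (- b)) ⟨
    a + ((o - o) + - b)    ≈⟨ +-congˡ (+-congʳ (-‿inverseʳ o)) ⟩
    a + (0# + - b)         ≈⟨ +-congˡ (+-identityˡ _) ⟩
    a - b                  ∎

  -- The map ℤ → R respects the difference m ⊖ n of naturals, which is
  -- how ℤ's addition of mixed signs is computed.
  embed-⊖ : ∀ m n → embed (m ℤ.⊖ n) ≈ m × 1# - n × 1#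
  embed-⊖ m       zero    = sym (trans (+-congˡ -0#≈0#) (+-identityʳ _))
  embed-⊖ zero    (suc n) = sym (+-identityˡ _)
  embed-⊖ (suc m) (suc n) = begin
    embed (suc m ℤ.⊖ suc n)   ≡⟨ ≡.cong embed (ℤ.[1+m]⊖[1+n]≡m⊖n m n) ⟩
    embed (m ℤ.⊖ n)           ≈⟨ embed-⊖ m n ⟩
    m × 1# - n × 1#           ≈⟨ sub-cancelˡ 1# _ _ ⟨
    suc m × 1# - suc n × 1#   ∎

  embed-+ : ∀ i j → embed (i ℤ.+ j) ≈ embed i + embed j
  embed-+ (+ m)    (+ n)    = ×-homo-+ 1# m n
  embed-+ (+ m)    -[1+ n ] = embed-⊖ m (suc n)
  embed-+ -[1+ m ] (+ n)    = trans (embed-⊖ n (suc m)) (+-comm _ _)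
  embed-+ -[1+ m ] -[1+ n ] = begin
    - (suc (suc (m ℕ.+ n)) × 1#)      ≡⟨ ≡.cong (λ k → - (suc k × 1#)) (ℕ.+-suc m n) ⟨
    - ((suc m ℕ.+ suc n) × 1#)        ≈⟨ -‿cong (×-homo-+ 1# (suc m) (suc n)) ⟩
    - (suc m × 1# + suc n × 1#)       ≈⟨ ⁻¹-∙-comm _ _ ⟨
    - (suc m × 1#) + - (suc n × 1#)   ∎

  embed-* : ∀ i j → embed (i ℤ.* j) ≈ embed i * embed j
  embed-* i j = begin
    embed (s ℤ.◃ ∣i∣ ℕ.* ∣j∣)
      ≈⟨ embed-◃ s (∣i∣ ℕ.* ∣j∣) ⟩
    signValue s * ((∣i∣ ℕ.* ∣j∣) × 1#)
      ≈⟨ *-cong (signValue-* (ℤ.sign i) (ℤ.sign j)) (×1-homo-* ∣i∣ ∣j∣) ⟩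
    (signValue (ℤ.sign i) * signValue (ℤ.sign j)) * (∣i∣ × 1# * ∣j∣ × 1#)
      ≈⟨ interchange _ _ _ _ ⟩
    (signValue (ℤ.sign i) * ∣i∣ × 1#) * (signValue (ℤ.sign j) * ∣j∣ × 1#)
      ≈⟨ *-cong (embed-sign-abs i) (embed-sign-abs j) ⟨
    embed i * embed j ∎
    where
    s : Sign
    s = ℤ.sign i Sign.* ℤ.sign j
    ∣i∣ ∣j∣ : ℕ
    ∣i∣ = ℤ.∣ i ∣
    ∣j∣ = ℤ.∣ j ∣
    open import Algebra.Properties.CommutativeSemigroup *-commutativeSemigroup using (interchange)

  embed-neg : ∀ i → embed (ℤ.- i) ≈ - embed i
  embed-neg (+ zero)  = sym -0#≈0#
  embed-neg (+ suc n) = refl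
  embed-neg -[1+ n ]  = sym (-‿involutive _)

  -- It agrees with embed but sends 1
  -- to 1# itself (rather than 1# + 0#), so that a polynomial using the
  -- constant 1 evaluates to a term containing 1# literally.
  ⟦_⟧ℤ : ℤ → Carrier
  ⟦ + 1 ⟧ℤ = 1#
  ⟦ i   ⟧ℤ = embed i

  ⟦⟧ℤ≈embed : ∀ i → ⟦ i ⟧ℤ ≈ embed i
  ⟦⟧ℤ≈embed (+ zero)        = refl
  ⟦⟧ℤ≈embed (+ suc zero)    = sym (+-identityʳ 1#)
  ⟦⟧ℤ≈embed (+ suc (suc n)) = refl
  ⟦⟧ℤ≈embed -[1+ n ]        = refl

  almostCommutativeRing : ACR.AlmostCommutativeRing c ℓ
  almostCommutativeRing = ACR.fromCommutativeRing R

  ℤ-morphism : ℤ.+-*-rawRing ACR.-Raw-AlmostCommutative⟶ almostCommutativeRing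
  ℤ-morphism = record
    { ⟦_⟧    = ⟦_⟧ℤ
    ; +-homo = λ i j → transport (embed-+ i j) (⟦⟧ℤ≈embed (i ℤ.+ j)) (+-cong (⟦⟧ℤ≈embed i) (⟦⟧ℤ≈embed j))
    ; *-homo = λ i j → transport (embed-* i j) (⟦⟧ℤ≈embed (i ℤ.* j)) (*-cong (⟦⟧ℤ≈embed i) (⟦⟧ℤ≈embed j))
    ; -‿homo = λ i → transport (embed-neg i) (⟦⟧ℤ≈embed (ℤ.- i)) (-‿cong (⟦⟧ℤ≈embed i))
    ; 0-homo = refl
    ; 1-homo = refl
    }
    where
    transport : ∀ {a b a′ b′} → a′ ≈ b′ → a ≈ a′ → b ≈ b′ → a ≈ b
    transport e a≈a′ b≈b′ = trans a≈a′ (trans e (sym b≈b′))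

  ℤ-coefficients-equal? : ∀ i j → Maybe (⟦ i ⟧ℤ ≈ ⟦ j ⟧ℤ)
  ℤ-coefficients-equal? i j with i ℤ.≟ j
  ... | yes ≡.refl = just refl
  ... | no _       = nothing

  open import Algebra.Solver.Ring ℤ.+-*-rawRing almostCommutativeRing ℤ-morphism ℤ-coefficients-equal? public
    using (Polynomial; solve; _:=_; con; _:+_; _:*_; _:-_)

module FieldFacts {c ℓ} (F : Field c ℓ) where
  open Field F
  open FieldOps F
  open IntegerCoefficients commutativeRing
  open import Relation.Binary.Reasoning.Setoid setoid

  nonzero-* : ∀ {a b} → ¬ (a ≈ 0#) → ¬ (b ≈ 0#) → ¬ (a * b ≈ 0#)
  nonzero-* {a} {b} a≉0 b≉0 ab≈0 = a≉0 (begin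
    a                ≈⟨ *-identityʳ a ⟨
    a * 1#           ≈⟨ *-congˡ (inverseʳ b b≉0) ⟨
    a * (b * b ⁻¹)   ≈⟨ *-assoc a b (b ⁻¹) ⟨
    (a * b) * b ⁻¹   ≈⟨ *-congʳ ab≈0 ⟩
    0# * b ⁻¹        ≈⟨ zeroˡ _ ⟩
    0#               ∎)

  nonzero-^ : ¬ (1# ≈ 0#) → ∀ {y} → ¬ (y ≈ 0#) → ∀ l → ¬ (y ^ᶠ l ≈ 0#)
  nonzero-^ 1≉0 y≉0 zero    = 1≉0
  nonzero-^ 1≉0 y≉0 (suc l) = nonzero-* y≉0 (nonzero-^ 1≉0 y≉0 l)

  -- Splitting a reciprocal: 1/q = p/(pq).  This lets all the denominators
  -- of the closed form be expressed through the largest one.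
  inverse-of-factor : ∀ {d} p q → d ≈ p * q → ¬ (d ≈ 0#) → q ⁻¹ ≈ p * d ⁻¹
  inverse-of-factor {d} p q d≈pq d≉0 = begin
    q ⁻¹                      ≈⟨ *-identityʳ _ ⟨
    q ⁻¹ * 1#                 ≈⟨ *-congˡ (inverseʳ d d≉0) ⟨
    q ⁻¹ * (d * d ⁻¹)         ≈⟨ *-congˡ (*-congʳ d≈pq) ⟩
    q ⁻¹ * ((p * q) * d ⁻¹)
      ≈⟨ solve 4 (λ q q⁻ p d⁻ → q⁻ :* ((p :* q) :* d⁻) := (q :* q⁻) :* (p :* d⁻)) refl q (q ⁻¹) p (d ⁻¹) ⟩
    (q * q ⁻¹) * (p * d ⁻¹)   ≈⟨ *-congʳ (inverseʳ q q≉0) ⟩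
    1# * (p * d ⁻¹)           ≈⟨ *-identityˡ _ ⟩
    p * d ⁻¹                  ∎
    where
    q≉0 : ¬ (q ≈ 0#)
    q≉0 q≈0 = d≉0 (trans d≈pq (trans (*-congˡ q≈0) (zeroʳ p)))

  clear-denominators : ∀ {y u v} → y ^ᶠ 1 * u ≈ 1# → y ^ᶠ 2 * v ≈ 1# →
                       ∀ p q r → p + q * u + r * v ≈ (y * y * p + y * q + r) * v
  clear-denominators {y} {u} {v} yu≈1 y²v≈1 p q r = begin
    p + q * u + r * v
      ≈⟨ +-congʳ (+-cong (sym (trans (*-congˡ y²v≈1) (*-identityʳ p))) (*-congˡ u≈yv)) ⟩
    p * (y ^ᶠ 2 * v) + q * (y * v) + r * v
      ≈⟨ solve 5 (λ y v p q r → p :* (y :* (y :* con (+ 1)) :* v) :+ q :* (y :* v) :+ r :* v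
                               := (y :* y :* p :+ y :* q :+ r) :* v) refl y v p q r ⟩
    (y * y * p + y * q + r) * v ∎
    where
    u≈yv : u ≈ y * v
    u≈yv = begin
      u                         ≈⟨ *-identityʳ u ⟨
      u * 1#                    ≈⟨ *-congˡ y²v≈1 ⟨
      u * (y ^ᶠ 2 * v)
        ≈⟨ solve 3 (λ y u v → u :* (y :* (y :* con (+ 1)) :* v) := (y :* con (+ 1) :* u) :* (y :* v)) refl y u v ⟩
      (y ^ᶠ 1 * u) * (y * v)    ≈⟨ *-congʳ yu≈1 ⟩
      1# * (y * v)              ≈⟨ *-identityˡ _ ⟩
      y * v                     ∎

  telescope : ∀ (g R : ℕ → Carrier) → R 0 ≈ 0# → ∀ n →
              (∀ k → suc k ≤ n → R (suc k) ≈ R k + g (suc k)) →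
              Σ[1to n ] g ≈ R n
  telescope g R R0≈0 zero    step = sym R0≈0
  telescope g R R0≈0 (suc n) step = begin
    Σ[1to n ] g + g (suc n)   ≈⟨ +-congʳ (telescope g R R0≈0 n (λ k k<n → step k (ℕ.m≤n⇒m≤1+n k<n))) ⟩
    R n + g (suc n)           ≈⟨ step n ℕ.≤-refl ⟨
    R (suc n)                 ∎

module ClosedForm {f ℓ} (F : Field f ℓ) (charZero : CharZero F) (x : Field.Carrier F) where
  open Field F
  open FieldOps F
  open IntegerCoefficients commutativeRing
  open FieldFacts F
  open import Relation.Binary.Reasoning.Setoid setoid

  P₂ : Carrier → Carrier
  P₂ N = (N - x) * (x + N + 1#) * (x * x + x + N + N * N)

  P₁ : Carrier
  P₁ = x * (x + 1#) * (ι 2 * x + 1#)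

  P₀ : Carrier → Carrier
  P₀ N = (ι 18 * (x * x) + ι 18 * x - ι 6 * N * x + 1# - ι 3 * N + ι 2 * (N * N)) * N

  closedForm : ℕ → Carrier
  closedForm n = (P₂ (ι n) * (ι 4) ⁻¹) * H 2 n x + (P₁ * (ι 2) ⁻¹) * H 1 n x - P₀ (ι n) * (ι 24) ⁻¹

  -- The closed form over the common denominator 24, with H⁽¹⁾ₙ and H⁽²⁾ₙ
  -- replaced by indeterminates h₁ and h₂.
  numerator : Carrier → Carrier → Carrier → Carrier
  numerator N h₁ h₂ = ι 6 * P₂ N * h₂ + ι 12 * P₁ * h₁ - P₀ N

  P₂ₚ P₀ₚ : ∀ {k} → Polynomial k → Polynomial k → Polynomial k
  P₂ₚ x N = (N :- x) :* (x :+ N :+ con (+ 1)) :* (x :* x :+ x :+ N :+ N :* N)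
  P₀ₚ x N = (con (+ 18) :* (x :* x) :+ con (+ 18) :* x :- con (+ 6) :* N :* x :+ con (+ 1)
             :- con (+ 3) :* N :+ con (+ 2) :* (N :* N)) :* N

  P₁ₚ : ∀ {k} → Polynomial k → Polynomial k
  P₁ₚ x = x :* (x :+ con (+ 1)) :* (con (+ 2) :* x :+ con (+ 1))

  numeratorₚ : ∀ {k} → Polynomial k → Polynomial k → Polynomial k → Polynomial k → Polynomial k
  numeratorₚ x N h₁ h₂ = con (+ 6) :* P₂ₚ x N :* h₂ :+ con (+ 12) :* P₁ₚ x :* h₁ :- P₀ₚ x N

  cubeₚ : ∀ {k} → Polynomial k → Polynomial k
  cubeₚ m = m :* (m :* (m :* con (+ 1)))

  24≉0 : ¬ (ι 24 ≈ 0#)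
  24≉0 = charZero 23

  numerator-form : ∀ n → closedForm n ≈ numerator (ι n) (H 1 n x) (H 2 n x) * (ι 24) ⁻¹
  numerator-form n = begin
    closedForm n
      ≈⟨ +-congʳ (+-cong (*-congʳ (*-congˡ 4⁻¹≈6/24)) (*-congʳ (*-congˡ 2⁻¹≈12/24))) ⟩
    (P₂ (ι n) * (ι 6 * c)) * H 2 n x + (P₁ * (ι 12 * c)) * H 1 n x - P₀ (ι n) * c
      ≈⟨ solve 6 (λ A B C h₁ h₂ c → (A :* (con (+ 6) :* c)) :* h₂ :+ (B :* (con (+ 12) :* c)) :* h₁ :- C :* c
                                  := (con (+ 6) :* A :* h₂ :+ con (+ 12) :* B :* h₁ :- C) :* c)
               refl (P₂ (ι n)) P₁ (P₀ (ι n)) (H 1 n x) (H 2 n x) c ⟩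
    numerator (ι n) (H 1 n x) (H 2 n x) * c ∎
    where
    c : Carrier
    c = (ι 24) ⁻¹
    4⁻¹≈6/24 : (ι 4) ⁻¹ ≈ ι 6 * c
    4⁻¹≈6/24 = inverse-of-factor (ι 6) (ι 4) (solve 0 (con (+ 24) := con (+ 6) :* con (+ 4)) refl) 24≉0
    2⁻¹≈12/24 : (ι 2) ⁻¹ ≈ ι 12 * c
    2⁻¹≈12/24 = inverse-of-factor (ι 12) (ι 2) (solve 0 (con (+ 24) := con (+ 12) :* con (+ 2)) refl) 24≉0

  -- The coefficients p and r of the remainder p + q/y + r/y² (with
  -- q = 12 P₁) left over in one step of the recurrence, where m = 1 + N.
  remainder₀ remainder₂ : Carrier → Carrier
  remainder₀ N = P₀ N - P₀ (1# + N)
  remainder₂ N = ι 6 * P₂ (1# + N) - ι 24 * (1# + N) ^ᶠ 3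

  -- Pure ring algebra: moving from N to m = 1 + N with h₁ ↦ h₁ + u and
  -- h₂ ↦ h₂ + v changes the numerator by 24 m³ (h₂ + v) plus the remainder;
  -- the main polynomial content is P₂ (1 + N) − P₂ N = 4 (1 + N)³.
  numerator-expansion : ∀ N h₁ h₂ u v →
    numerator (1# + N) (h₁ + u) (h₂ + v)
      ≈ numerator N h₁ h₂ + ι 24 * ((1# + N) ^ᶠ 3 * (h₂ + v))
        + (remainder₀ N + ι 12 * P₁ * u + remainder₂ N * v)
  numerator-expansion N h₁ h₂ u v =
    solve 6 (λ x N h₁ h₂ u v → let m = con (+ 1) :+ N in
               numeratorₚ x m (h₁ :+ u) (h₂ :+ v)
               := numeratorₚ x N h₁ h₂ :+ con (+ 24) :* (cubeₚ m :* (h₂ :+ v))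
                  :+ ((P₀ₚ x N :- P₀ₚ x m) :+ con (+ 12) :* P₁ₚ x :* u
                      :+ (con (+ 6) :* P₂ₚ x m :- con (+ 24) :* cubeₚ m) :* v))
          refl x N h₁ h₂ u v

  remainder-vanishes : ∀ N → let y = x + (1# + N) in
    y * y * remainder₀ N + y * (ι 12 * P₁) + remainder₂ N ≈ 0#
  remainder-vanishes N =
    solve 2 (λ x N → let m = con (+ 1) :+ N ; y = x :+ m in
               y :* y :* (P₀ₚ x N :- P₀ₚ x m) :+ y :* (con (+ 12) :* P₁ₚ x)
               :+ (con (+ 6) :* P₂ₚ x m :- con (+ 24) :* cubeₚ m)
               := con (+ 0))
          refl x N

  numerator-step : ∀ N h₁ h₂ u v → let y = x + (1# + N) in
    y ^ᶠ 1 * u ≈ 1# → y ^ᶠ 2 * v ≈ 1# →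
    numerator (1# + N) (h₁ + u) (h₂ + v) ≈ numerator N h₁ h₂ + ι 24 * ((1# + N) ^ᶠ 3 * (h₂ + v))
  numerator-step N h₁ h₂ u v yu≈1 y²v≈1 = begin
    numerator (1# + N) (h₁ + u) (h₂ + v)                  ≈⟨ numerator-expansion N h₁ h₂ u v ⟩
    T + (remainder₀ N + ι 12 * P₁ * u + remainder₂ N * v)  ≈⟨ +-congˡ remainder≈0 ⟩
    T + 0#                                                 ≈⟨ +-identityʳ T ⟩
    T                                                      ∎
    where
    T : Carrier
    T = numerator N h₁ h₂ + ι 24 * ((1# + N) ^ᶠ 3 * (h₂ + v))
    remainder≈0 : remainder₀ N + ι 12 * P₁ * u + remainder₂ N * v ≈ 0#
    remainder≈0 = begin
      remainder₀ N + ι 12 * P₁ * u + remainder₂ N * v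
        ≈⟨ clear-denominators yu≈1 y²v≈1 (remainder₀ N) (ι 12 * P₁) (remainder₂ N) ⟩
      (y * y * remainder₀ N + y * (ι 12 * P₁) + remainder₂ N) * v  ≈⟨ *-congʳ (remainder-vanishes N) ⟩
      0# * v                                                       ≈⟨ zeroˡ v ⟩
      0#                                                           ∎
      where
      y : Carrier
      y = x + (1# + N)

  -- The empty sum: all harmonic numbers vanish and P₀ 0 = 0.
  closedForm-zero : closedForm 0 ≈ 0#
  closedForm-zero = begin
    closedForm 0                     ≈⟨ numerator-form 0 ⟩
    numerator 0# 0# 0# * (ι 24) ⁻¹
      ≈⟨ *-congʳ (solve 1 (λ x → numeratorₚ x (con (+ 0)) (con (+ 0)) (con (+ 0)) := con (+ 0)) refl x) ⟩
    0# * (ι 24) ⁻¹                   ≈⟨ zeroˡ _ ⟩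
    0#                               ∎

  closedForm-step : ∀ n → ¬ (x + ι (suc n) ≈ 0#) →
    closedForm (suc n) ≈ closedForm n + ι (suc n) ^ᶠ 3 * H 2 (suc n) x
  closedForm-step n y≉0 = begin
    closedForm (suc n)
      ≈⟨ numerator-form (suc n) ⟩
    numerator (ι (suc n)) (h₁ + u) (h₂ + v) * c
      ≈⟨ *-congʳ (numerator-step (ι n) h₁ h₂ u v (inverseʳ _ (y^≉0 1)) (inverseʳ _ (y^≉0 2))) ⟩
    (numerator (ι n) h₁ h₂ + ι 24 * W) * c
      ≈⟨ solve 4 (λ T d W c → (T :+ d :* W) :* c := T :* c :+ W :* (d :* c)) refl (numerator (ι n) h₁ h₂) (ι 24) W c ⟩
    numerator (ι n) h₁ h₂ * c + W * (ι 24 * c)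
      ≈⟨ +-cong (numerator-form n) (*-congˡ (sym (inverseʳ (ι 24) 24≉0))) ⟨
    closedForm n + W * 1#
      ≈⟨ +-congˡ (*-identityʳ W) ⟩
    closedForm n + W ∎
    where
    h₁ h₂ u v c W : Carrier
    h₁ = H 1 n x
    h₂ = H 2 n x
    u  = ((x + ι (suc n)) ^ᶠ 1) ⁻¹
    v  = ((x + ι (suc n)) ^ᶠ 2) ⁻¹
    c  = (ι 24) ⁻¹
    W  = ι (suc n) ^ᶠ 3 * (h₂ + v)
    y^≉0 : ∀ l → ¬ ((x + ι (suc n)) ^ᶠ l ≈ 0#)
    y^≉0 = nonzero-^ (λ 1≈0 → charZero 0 (trans (+-identityʳ 1#) 1≈0)) y≉0

proposition15 : ∀ {c ℓ} (F : Field c ℓ) → CharZero F →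
    let open Field F
        open FieldOps F
    in (x : Carrier) (n : ℕ) →
       (∀ k → 1 ≤ k → k ≤ n → ¬ (x + ι k ≈ 0#)) →
       Σ[1to n ] (λ k → (ι k ^ᶠ 3) * H 2 k x)
         ≈ (((ι n - x) * (x + ι n + 1#) * (x * x + x + ι n + ι n * ι n)) * (ι 4) ⁻¹) * H 2 n x
           + ((x * (x + 1#) * (ι 2 * x + 1#)) * (ι 2) ⁻¹) * H 1 n x
           - ((ι 18 * (x * x) + ι 18 * x - ι 6 * ι n * x + 1# - ι 3 * ι n + ι 2 * (ι n * ι n)) * ι n) * (ι 24) ⁻¹
proposition15 F charZero x n avoidsPoles =
  telescope (λ k → ι k ^ᶠ 3 * H 2 k x) closedForm closedForm-zero n
    (λ k k<n → closedForm-step k (avoidsPoles (suc k) (s≤s z≤n) k<n))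
  where
  open Field F
  open FieldOps F
  open FieldFacts F
  open ClosedForm F charZero x
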